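{- For any pair $(n,k)$ of positive integers: (a) if $(n,k)$ is extremely good, then the greedy algorithm is completely universally optimal on $(n,k)$; (b) if $(n,k)$ is good, then the greedy algorithm is universally optimal on $(n,k)$.
   Context: All graphs are finite, undirected and unweighted. A $k$-spanner of $G=(V,E)$ is a subgraph $H=(V,E')$, $E'\subseteq E$, with $\mathsf{dist}_H(u,v)\le k\cdot\mathsf{dist}_G(u,v)$ for all $u,v\in V$, where $\mathsf{dist}$ is shortest-path length. A minimum $k$-spanner of $G$ is a $k$-spanner with the fewest edges. The girth of a graph is the length of its shortest cycle ($\infty$ if acyclic). The greedy algorithm on input $\langle G,k\rangle$ with a total order $\sigma=(e_1<\dots<e_m)$ of $E$: start with $H=(V,\emptyset)$; for $i=1,\dots,m$, add $e_i=(u,v)$ to $H$ if currently $\mathsf{dist}_H(u,v)>k$; output the final $H$. Definitions: $(n,k)$ is extremely good if for every $n$-vertex graph, all of its minimum $k$-spanners have girth at least $k+2$; $(n,k)$ is good if for every $n$-vertex graph, at least one of its minimum $k$-spanners has girth at least $k+2$. The greedy algorithm is completely universally optimal on $(n,k)$ if for every $n$-vertex graph $G$, every minimum $k$-spanner of $G$ is the output of the greedy algorithm on $\langle G,k\rangle$ for some edge ordering $\sigma$; it is universally optimal on $(n,k)$ if for every $n$-vertex graph $G$, some minimum $k$-spanner of $G$ is the output of the greedy algorithm on $\langle G,k\rangle$ for some edge ordering $\sigma$. -}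

module Defs where

open import Data.Nat using (ℕ; zero; suc; _*_; _≤_; _<_; _+_)
open import Data.Nat.Properties using (_<?_)
open import Data.Bool using (Bool; true; false; _∧_; _∨_; if_then_else_)
open import Data.Fin using (Fin; toℕ; _≟_)
open import Data.List using (List; []; _∷_; length; filter; allFin; concatMap; map)
open import Data.Bool.ListAction using (any)
open import Data.List.Relation.Unary.Unique.Propositional using (Unique)
open import Data.List.Relation.Binary.Permutation.Propositional using (_↭_)
open import Data.Product using (_×_; _,_; Σ; ∃)
open import Data.Unit using (⊤)
open import Relation.Nullary.Decidable using (⌊_⌋)
open import Relation.Binary.PropositionalEquality using (_≡_)

record Graph (n : ℕ) : Set where
  field
    adj    : Fin n → Fin n → Bool
    sym    : ∀ i j → adj i j ≡ adj j i
    irrefl : ∀ i → adj i i ≡ false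
open Graph public

Adj : ℕ → Set
Adj n = Fin n → Fin n → Bool

-- reach A m u v = true  iff  there is a walk of length ≤ m from u to v,
-- i.e. dist_A(u,v) ≤ m.
reach : ∀ {n} → Adj n → ℕ → Fin n → Fin n → Bool
reach {n} A zero    u v = ⌊ u ≟ v ⌋
reach {n} A (suc m) u v = reach A m u v ∨ any (λ w → A u w ∧ reach A m w v) (allFin n)

allPairs : (n : ℕ) → List (Fin n × Fin n)
allPairs n = concatMap (λ i → map (λ j → (i , j)) (allFin n)) (allFin n)

edgeList : ∀ {n} → Graph n → List (Fin n × Fin n)
edgeList {n} G =
  filter (λ p → Data.Bool._≟_ (⌊ toℕ (Data.Product.proj₁ p) <? toℕ (Data.Product.proj₂ p) ⌋ ∧ adj G (Data.Product.proj₁ p) (Data.Product.proj₂ p)) true)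
         (allPairs n)

∣E∣ : ∀ {n} → Graph n → ℕ
∣E∣ G = length (edgeList G)

_⊆G_ : ∀ {n} → Graph n → Graph n → Set
H ⊆G G = ∀ i j → adj H i j ≡ true → adj G i j ≡ true

IsSpanner : ∀ {n} → ℕ → Graph n → Graph n → Set
IsSpanner k G H = H ⊆G G × (∀ u v d → reach (adj G) d u v ≡ true → reach (adj H) (k * d) u v ≡ true)

IsMinSpanner : ∀ {n} → ℕ → Graph n → Graph n → Set
IsMinSpanner k G H = IsSpanner k G H × (∀ H' → IsSpanner k G H' → ∣E∣ H ≤ ∣E∣ H')

chain : ∀ {n} → Adj n → Fin n → List (Fin n) → Set
chain A x []       = ⊤
chain A x (y ∷ ys) = A x y ≡ true × chain A y ys

lastOf : ∀ {n} → Fin n → List (Fin n) → Fin n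
lastOf x []       = x
lastOf x (y ∷ ys) = lastOf y ys

IsCycle : ∀ {n} → Adj n → Fin n → List (Fin n) → Set
IsCycle A x xs = 3 ≤ suc (length xs) × Unique (x ∷ xs) × chain A x xs × A (lastOf x xs) x ≡ true

-- girth(G) ≥ g : every cycle has length ≥ g  (vacuous when acyclic, girth = ∞)
GirthAtLeast : ∀ {n} → ℕ → Graph n → Set
GirthAtLeast g G = ∀ x xs → IsCycle (adj G) x xs → g ≤ suc (length xs)

adjOf : ∀ {n} → List (Fin n × Fin n) → Adj n
adjOf L i j = any (λ p → (⌊ Data.Product.proj₁ p ≟ i ⌋ ∧ ⌊ Data.Product.proj₂ p ≟ j ⌋)
                       ∨ (⌊ Data.Product.proj₁ p ≟ j ⌋ ∧ ⌊ Data.Product.proj₂ p ≟ i ⌋)) L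

greedyStep : ∀ {n} → ℕ → List (Fin n × Fin n) → List (Fin n × Fin n) → List (Fin n × Fin n)
greedyStep k H []             = H
greedyStep k H ((u , v) ∷ σ)  =
  greedyStep k (if reach (adjOf H) k u v then H else (u , v) ∷ H) σ

greedy : ∀ {n} → ℕ → List (Fin n × Fin n) → Adj n
greedy k σ = adjOf (greedyStep k [] σ)

IsGreedyOutput : ∀ {n} → ℕ → Graph n → Graph n → Set
IsGreedyOutput {n} k G H =
  Σ (List (Fin n × Fin n)) λ σ → (σ ↭ edgeList G) × (∀ i j → adj H i j ≡ greedy k σ i j)

ExtremelyGood : ℕ → ℕ → Set
ExtremelyGood n k = ∀ (G H : Graph n) → IsMinSpanner k G H → GirthAtLeast (k + 2) H

Good : ℕ → ℕ → Set
Good n k = ∀ (G : Graph n) → Σ (Graph n) λ H → IsMinSpanner k G H × GirthAtLeast (k + 2) H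

CompletelyUniversallyOptimal : ℕ → ℕ → Set
CompletelyUniversallyOptimal n k = ∀ (G H : Graph n) → IsMinSpanner k G H → IsGreedyOutput k G H

UniversallyOptimal : ℕ → ℕ → Set
UniversallyOptimal n k = ∀ (G : Graph n) → Σ (Graph n) λ H → IsMinSpanner k G H × IsGreedyOutput k G H

{-# OPTIONS --safe #-}
-- If H is a k-spanner of G of girth at least k + 2, run the greedy algorithm on
-- the edges of H first and then on the remaining edges of G. An edge uv of H is
-- always accepted: the edges chosen so far lie in H − uv, and a u–v path of
-- length at most k there would close a cycle of length at most k + 1 with uv.
-- Every later edge is rejected, since H already joins its ends within distance k.
-- So the output is H itself.
module Submission where

open import Defs
open import Data.Nat using (ℕ; suc; _≤_; _<_; _+_; _*_; z≤n; s≤s)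
open import Data.Nat.Properties using (<-cmp; <-asym; ≤-refl; ≤-trans; ≤-pred; ≤⇒≯; m≤n⇒m≤1+n; +-comm; *-identityʳ; _<?_)
open import Data.Bool using (Bool; true; false; _∧_; _∨_; T)
open import Data.Bool.Properties using (T-≡; T-∧; T-∨; ⇔→≡)
import Data.Bool.Properties as Bool
open import Data.Bool.ListAction using (any; or)
open import Data.Fin using (Fin; toℕ; _≟_)
open import Data.Fin.Properties using (toℕ-injective)
open import Data.List using (List; []; _∷_; [_]; _++_; _ʳ++_; reverse; length; filter; allFin; map; concatMap; cartesianProduct)
open import Data.List.Properties using (++-assoc; map-cong; filter-reject; partition-defn)
open import Data.List.Membership.Propositional using (_∈_; _∉_; lose)
open import Data.List.Membership.Propositional.Properties using (∈-++⁺ˡ; ∈-++⁺ʳ; ∈-filter⁺; ∈-filter⁻; ∈-allFin; ∈-cartesianProduct⁺)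
import Data.List.Membership.DecPropositional as DecMembership
open import Data.List.Relation.Binary.Subset.Propositional using (_⊆_)
open import Data.List.Relation.Unary.All as All using (All; []; _∷_)
open import Data.List.Relation.Unary.All.Properties using (¬Any⇒All¬)
open import Data.List.Relation.Unary.Any as Any using (here; there; satisfied)
open import Data.List.Relation.Unary.Any.Properties using (any⁺; any⁻; Any-⊎⁺; Any-⊎⁻)
open import Data.List.Relation.Unary.AllPairs using ([]; _∷_)
open import Data.List.Relation.Unary.Unique.Propositional using (Unique)
import Data.List.Relation.Unary.Unique.Propositional.Properties as Unique
open import Data.List.Relation.Binary.Permutation.Propositional using (_↭_; ↭-sym; ↭ₛ⇒↭)
open import Data.List.Relation.Binary.Permutation.Propositional.Properties using (Any-resp-↭; ↭-reverse)
import Data.List.Relation.Binary.Permutation.Setoid.Properties as ↭ₛ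
open import Data.Product using (_×_; ∃-syntax; _,_; proj₁; proj₂)
open import Data.Sum using (_⊎_; inj₁; inj₂)
open import Data.Unit using (tt)
open import Data.Empty using (⊥-elim)
open import Function using (_∘_; id; Equivalence; mk⇔)
open import Relation.Binary.Definitions using (tri<; tri≈; tri>)
open import Relation.Binary.PropositionalEquality using (_≡_; _≢_; refl; trans; cong; cong₂; subst; ≡-≟-identity; module ≡-Reasoning)
import Relation.Binary.PropositionalEquality as ≡
open import Relation.Nullary using (yes; no; does)
open import Relation.Nullary.Decidable using (⌊_⌋; toWitness; fromWitness)
open import Relation.Unary using (Pred; Decidable)
open import Relation.Unary.Properties using (∁?)

open Equivalence using (to; from)

private variable
  X : Set
  n k : ℕ
  i j u v x y : Fin n
  A B : Adj n
  G H : Graph n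
  ys : List (Fin n)
  acc pre : List (Fin n × Fin n)

_⊆ᴬ_ : Adj n → Adj n → Set
A ⊆ᴬ B = ∀ i j → A i j ≡ true → B i j ≡ true

filter-filter-⊆ : ∀ {p q} {P : Pred X p} {Q : Pred X q} (P? : Decidable P) (Q? : Decidable Q) →
  (∀ {x} → P x → Q x) → ∀ xs → filter P? (filter Q? xs) ≡ filter P? xs
filter-filter-⊆ P? Q? P⇒Q [] = refl
filter-filter-⊆ P? Q? P⇒Q (x ∷ xs) with Q? x
... | no ¬Qx = trans (filter-filter-⊆ P? Q? P⇒Q xs) (≡.sym (filter-reject P? (¬Qx ∘ P⇒Q)))
... | yes _ with does (P? x)
...   | true  = cong (x ∷_) (filter-filter-⊆ P? Q? P⇒Q xs)
...   | false = filter-filter-⊆ P? Q? P⇒Q xs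

filter-++-filter-∁-↭ : ∀ {p} {P : Pred X p} (P? : Decidable P) xs →
  filter P? xs ++ filter (∁? P?) xs ↭ xs
filter-++-filter-∁-↭ P? xs =
  ↭-sym (subst (λ parts → xs ↭ proj₁ parts ++ proj₂ parts) (partition-defn P? xs)
               (↭ₛ⇒↭ (↭ₛ.partition-↭ (≡.setoid _) P? xs)))

any-resp-↭ : ∀ (p : X → Bool) {xs ys} → xs ↭ ys → any p xs ≡ any p ys
any-resp-↭ p {xs} {ys} xs↭ys = ⇔→≡ {z = true} (mk⇔ (transport xs↭ys) (transport (↭-sym xs↭ys)))
  where
  transport : ∀ {as bs} → as ↭ bs → any p as ≡ true → any p bs ≡ true
  transport {as} as↭bs = to T-≡ ∘ any⁺ p ∘ Any-resp-↭ as↭bs ∘ any⁻ p as ∘ from T-≡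

Unique-++-∷⇒∉ : ∀ (xs : List X) {x xs′} → Unique (xs ++ x ∷ xs′) → x ∉ xs
Unique-++-∷⇒∉ (_ ∷ xs) (x∉ ∷ _)  (here refl) = All.lookup x∉ (∈-++⁺ʳ xs (here refl)) refl
Unique-++-∷⇒∉ (_ ∷ xs) (_ ∷ uniq) (there x∈) = Unique-++-∷⇒∉ xs uniq x∈

Walk : Adj n → Fin n → Fin n → List (Fin n) → Set
Walk A u v ys = chain A u ys × lastOf u ys ≡ v

Path : Adj n → Fin n → Fin n → List (Fin n) → Set
Path A u v ys = Walk A u v ys × Unique (u ∷ ys)

chain-mono : A ⊆ᴬ B → chain A u ys → chain B u ys
chain-mono {ys = []}     A⊆B tt         = tt
chain-mono {ys = y ∷ ys} A⊆B (Auy , c) = A⊆B _ y Auy , chain-mono A⊆B c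

reach⇒walk : ∀ m → reach A m u v ≡ true → ∃[ ys ] Walk A u v ys × length ys ≤ m
reach⇒walk {u = u} {v} 0 r with refl ← toWitness {a? = u ≟ v} (from T-≡ r) = [] , (tt , refl) , z≤n
reach⇒walk {A = A} (suc m) r with to T-∨ (from T-≡ r)
... | inj₁ within-m =
  let ys , walk , ys≤m = reach⇒walk m (to T-≡ within-m) in ys , walk , m≤n⇒m≤1+n ys≤m
... | inj₂ via-neighbour with satisfied (any⁻ _ (allFin _) via-neighbour)
...   | w , step with to T-∧ step
...     | Auw , rest =
  let ys , (c , e) , ys≤m = reach⇒walk m (to T-≡ rest) in w ∷ ys , ((to T-≡ Auw , c) , e) , s≤s ys≤m

reach-edge : ∀ (A : Adj n) → A u v ≡ true → reach A 1 u v ≡ true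
reach-edge {v = v} A Auv =
  to T-≡ (from T-∨ (inj₂ (any⁺ _ (lose (∈-allFin v) (from T-∧ (from T-≡ Auv , fromWitness refl))))))

reach-cong : (∀ i j → A i j ≡ B i j) → ∀ m u v → reach A m u v ≡ reach B m u v
reach-cong A≗B 0       u v = refl
reach-cong A≗B (suc m) u v =
  cong₂ _∨_ (reach-cong A≗B m u v)
            (cong or (map-cong (λ w → cong₂ _∧_ (A≗B u w) (reach-cong A≗B m w v)) (allFin _)))

path-suffix : x ∈ y ∷ ys → Path A y v ys → ∃[ zs ] Path A x v zs × length zs ≤ length ys
path-suffix (here refl) path = _ , path , ≤-refl
path-suffix {ys = _ ∷ _} (there x∈) (((_ , c) , e) , _ ∷ uniq) =
  let zs , path , zs≤ys = path-suffix x∈ ((c , e) , uniq) in zs , path , m≤n⇒m≤1+n zs≤ys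

walk⇒path : Walk A u v ys → ∃[ zs ] Path A u v zs × length zs ≤ length ys
walk⇒path {ys = []} walk = [] , (walk , [] ∷ []) , z≤n
walk⇒path {u = u} {ys = y ∷ ys} ((Auy , c) , e) with walk⇒path (c , e)
... | zs , ((c′ , e′) , uniq) , zs≤ys with DecMembership._∈?_ _≟_ u (y ∷ zs)
...   | yes u∈ = let ws , path , ws≤zs = path-suffix u∈ ((c′ , e′) , uniq)
                 in ws , path , m≤n⇒m≤1+n (≤-trans ws≤zs zs≤ys)
...   | no u∉  = y ∷ zs , (((Auy , c′) , e′) , ¬Any⇒All¬ _ u∉ ∷ uniq) , s≤s zs≤ys

girth⇒long-detour : ∀ (H : Graph n) → GirthAtLeast (k + 2) H → A ⊆ᴬ adj H →
  adj H u v ≡ true → A u v ≢ true → Path A u v ys → k < length ys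
girth⇒long-detour {u = u} {ys = []} H _ _ Huu _ ((_ , refl) , _)
  with () ← trans (≡.sym Huu) (irrefl H u)
girth⇒long-detour {ys = _ ∷ []} _ _ _ _ ¬Auv (((Auv , _) , refl) , _) = ⊥-elim (¬Auv Auv)
girth⇒long-detour {k = k} {ys = ys@(_ ∷ _ ∷ _)} H girth A⊆H Huv _ ((c , refl) , uniq) =
  ≤-pred (subst (_≤ suc (length ys)) (+-comm k 2) k+2≤cycle)
  where
  k+2≤cycle : k + 2 ≤ suc (length ys)
  k+2≤cycle = girth _ ys (s≤s (s≤s (s≤s z≤n)) , uniq , chain-mono A⊆H c ,
                          trans (Graph.sym H _ _) Huv)

girth⇒¬short-detour : ∀ (H : Graph n) → GirthAtLeast (k + 2) H → A ⊆ᴬ adj H →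
  adj H u v ≡ true → A u v ≢ true → reach A k u v ≢ true
girth⇒¬short-detour H girth A⊆H Huv ¬Auv r =
  let ys , walk , ys≤k  = reach⇒walk _ r
      zs , path , zs≤ys = walk⇒path walk
  in ≤⇒≯ (≤-trans zs≤ys ys≤k) (girth⇒long-detour H girth A⊆H Huv ¬Auv path)

matchesᵇ : Fin n → Fin n → Fin n × Fin n → Bool
matchesᵇ i j p = (⌊ proj₁ p ≟ i ⌋ ∧ ⌊ proj₂ p ≟ j ⌋) ∨ (⌊ proj₁ p ≟ j ⌋ ∧ ⌊ proj₂ p ≟ i ⌋)

Joins : Fin n → Fin n → Fin n × Fin n → Set
Joins i j p = (i , j) ≡ p ⊎ (j , i) ≡ p

matchesᵇ⁺ : ∀ p → Joins i j p → T (matchesᵇ i j p)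
matchesᵇ⁺ {i = i} {j} _ (inj₁ refl)
  rewrite ≡-≟-identity _≟_ {i} refl | ≡-≟-identity _≟_ {j} refl = tt
matchesᵇ⁺ {i = i} {j} _ (inj₂ refl)
  rewrite ≡-≟-identity _≟_ {i} refl | ≡-≟-identity _≟_ {j} refl = from T-∨ (inj₂ tt)

matchesᵇ⁻ : ∀ p → T (matchesᵇ i j p) → Joins i j p
matchesᵇ⁻ {i = i} {j} (a , b) t with to T-∨ t
... | inj₁ t′ with refl ← toWitness {a? = a ≟ i} (proj₁ (to T-∧ t′))
               | refl ← toWitness {a? = b ≟ j} (proj₂ (to T-∧ t′)) = inj₁ refl
... | inj₂ t′ with refl ← toWitness {a? = a ≟ j} (proj₁ (to T-∧ t′))
               | refl ← toWitness {a? = b ≟ i} (proj₂ (to T-∧ t′)) = inj₂ refl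

adjOf⁺ : ∀ (es : List (Fin n × Fin n)) → (i , j) ∈ es ⊎ (j , i) ∈ es → adjOf es i j ≡ true
adjOf⁺ es = to T-≡ ∘ any⁺ _ ∘ Any.map (matchesᵇ⁺ _) ∘ Any-⊎⁺

adjOf⁻ : ∀ (es : List (Fin n × Fin n)) → adjOf es i j ≡ true → (i , j) ∈ es ⊎ (j , i) ∈ es
adjOf⁻ es = Any-⊎⁻ ∘ Any.map (matchesᵇ⁻ _) ∘ any⁻ _ es ∘ from T-≡

adjOf-↭ : ∀ {es es′ : List (Fin n × Fin n)} → es ↭ es′ → ∀ i j → adjOf es i j ≡ adjOf es′ i j
adjOf-↭ es↭es′ i j = any-resp-↭ (matchesᵇ i j) es↭es′

edgeᵇ : Graph n → Fin n × Fin n → Bool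
edgeᵇ H p = ⌊ toℕ (proj₁ p) <? toℕ (proj₂ p) ⌋ ∧ adj H (proj₁ p) (proj₂ p)

IsEdge? : (H : Graph n) → Decidable (λ p → edgeᵇ H p ≡ true)
IsEdge? H p = edgeᵇ H p Bool.≟ true

allPairs≡cartesianProduct : ∀ n → allPairs n ≡ cartesianProduct (allFin n) (allFin n)
allPairs≡cartesianProduct n = go (allFin n)
  where
  go : ∀ is → concatMap (λ i → map (i ,_) (allFin n)) is ≡ cartesianProduct is (allFin n)
  go []       = refl
  go (i ∷ is) = cong (map (i ,_) (allFin n) ++_) (go is)

∈-allPairs : ∀ (i j : Fin n) → (i , j) ∈ allPairs n
∈-allPairs i j = subst ((i , j) ∈_) (≡.sym (allPairs≡cartesianProduct _))
                       (∈-cartesianProduct⁺ (∈-allFin i) (∈-allFin j))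

edgeList-unique : ∀ (H : Graph n) → Unique (edgeList H)
edgeList-unique {n} H =
  Unique.filter⁺ (IsEdge? H) (subst Unique (≡.sym (allPairs≡cartesianProduct n))
                                  (Unique.cartesianProduct⁺ (Unique.allFin⁺ n) (Unique.allFin⁺ n)))

∈-edgeList⁺ : ∀ (H : Graph n) → toℕ i < toℕ j → adj H i j ≡ true → (i , j) ∈ edgeList H
∈-edgeList⁺ {i = i} {j} H i<j Hij =
  ∈-filter⁺ (IsEdge? H) (∈-allPairs i j) (to T-≡ (from T-∧ (fromWitness i<j , from T-≡ Hij)))

∈-edgeList⁻ : ∀ (H : Graph n) → (i , j) ∈ edgeList H → toℕ i < toℕ j × adj H i j ≡ true
∈-edgeList⁻ H ij∈
  with i<j , Hij ← to T-∧ (from T-≡ (proj₂ (∈-filter⁻ (IsEdge? H) {xs = allPairs _} ij∈)))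
  = toWitness i<j , to T-≡ Hij

adj⇒∈-edgeList : ∀ (H : Graph n) → adj H i j ≡ true → (i , j) ∈ edgeList H ⊎ (j , i) ∈ edgeList H
adj⇒∈-edgeList {i = i} {j} H Hij with <-cmp (toℕ i) (toℕ j)
... | tri< i<j _ _ = inj₁ (∈-edgeList⁺ H i<j Hij)
... | tri> _ _ j<i = inj₂ (∈-edgeList⁺ H j<i (trans (Graph.sym H j i) Hij))
... | tri≈ _ i≡j _ with refl ← toℕ-injective i≡j with () ← trans (≡.sym Hij) (irrefl H i)

adjOf-⊆-edgeList : ∀ (H : Graph n) {es} → es ⊆ edgeList H → adjOf es ⊆ᴬ adj H
adjOf-⊆-edgeList H {es} es⊆E i j e with adjOf⁻ es e
... | inj₁ ij∈ = proj₂ (∈-edgeList⁻ H (es⊆E ij∈))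
... | inj₂ ji∈ = trans (Graph.sym H i j) (proj₂ (∈-edgeList⁻ H (es⊆E ji∈)))

adj≡adjOf-reverse-edgeList : ∀ (H : Graph n) i j → adj H i j ≡ adjOf (reverse (edgeList H)) i j
adj≡adjOf-reverse-edgeList H i j = begin
  adj H i j                        ≡⟨ ⇔→≡ {z = true} (mk⇔ (adjOf⁺ (edgeList H) ∘ adj⇒∈-edgeList H)
                                                           (adjOf-⊆-edgeList H id i j)) ⟩
  adjOf (edgeList H) i j           ≡⟨ adjOf-↭ (↭-reverse (edgeList H)) i j ⟨
  adjOf (reverse (edgeList H)) i j ∎
  where open ≡-Reasoning

greedyStep-++ : ∀ acc (es es′ : List (Fin n × Fin n)) →
  greedyStep k acc (es ++ es′) ≡ greedyStep k (greedyStep k acc es) es′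
greedyStep-++ acc []            es′ = refl
greedyStep-++ acc ((u , v) ∷ es) es′ = greedyStep-++ _ es es′

greedyStep-rejects : ∀ {es} → All (λ p → reach (adjOf acc) k (proj₁ p) (proj₂ p) ≡ true) es →
  greedyStep k acc es ≡ acc
greedyStep-rejects []       = refl
greedyStep-rejects (r ∷ rs) rewrite r = greedyStep-rejects rs

greedyStep-accepts : ∀ (H : Graph n) → GirthAtLeast (k + 2) H → ∀ pre es {acc} →
  edgeList H ≡ pre ++ es → acc ⊆ pre → greedyStep k acc es ≡ es ʳ++ acc
greedyStep-accepts H girth pre []             split acc⊆pre = refl
greedyStep-accepts {k = k} H girth pre ((u , v) ∷ es) {acc} split acc⊆pre
  with reach (adjOf acc) k u v in r
... | true  = ⊥-elim (girth⇒¬short-detour H girth (adjOf-⊆-edgeList H acc⊆E) Huv uv∉acc r)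
  where
  acc⊆E : acc ⊆ edgeList H
  acc⊆E = subst (_ ∈_) (≡.sym split) ∘ ∈-++⁺ˡ ∘ acc⊆pre
  uv∈E : (u , v) ∈ edgeList H
  uv∈E = subst (_ ∈_) (≡.sym split) (∈-++⁺ʳ pre (here refl))
  Huv : adj H u v ≡ true
  Huv = proj₂ (∈-edgeList⁻ H uv∈E)
  uv∉acc : adjOf acc u v ≢ true
  uv∉acc e with adjOf⁻ acc e
  ... | inj₁ uv∈ = Unique-++-∷⇒∉ pre (subst Unique split (edgeList-unique H)) (acc⊆pre uv∈)
  ... | inj₂ vu∈ = <-asym (proj₁ (∈-edgeList⁻ H uv∈E)) (proj₁ (∈-edgeList⁻ H (acc⊆E vu∈)))
... | false = greedyStep-accepts H girth (pre ++ [ u , v ]) es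
                (trans split (≡.sym (++-assoc pre [ u , v ] es))) uv∷acc⊆pre′
  where
  uv∷acc⊆pre′ : (u , v) ∷ acc ⊆ pre ++ [ u , v ]
  uv∷acc⊆pre′ (here refl) = ∈-++⁺ʳ pre (here refl)
  uv∷acc⊆pre′ (there p∈)  = ∈-++⁺ˡ (acc⊆pre p∈)

edgesFirst : Graph n → Graph n → List (Fin n × Fin n)
edgesFirst G H = edgeList H ++ filter (∁? (IsEdge? H)) (edgeList G)

edgeᵇ-mono : ∀ (G H : Graph n) → H ⊆G G → ∀ p → edgeᵇ H p ≡ true → edgeᵇ G p ≡ true
edgeᵇ-mono G H H⊆G (i , j) e with i<j , Hij ← to T-∧ (from T-≡ e) =
  to T-≡ (from T-∧ (i<j , from T-≡ (H⊆G i j (to T-≡ Hij))))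

edgesFirst-↭ : ∀ (G H : Graph n) → H ⊆G G → edgesFirst G H ↭ edgeList G
edgesFirst-↭ G H H⊆G =
  subst (λ es → es ++ filter (∁? (IsEdge? H)) (edgeList G) ↭ edgeList G)
        (filter-filter-⊆ (IsEdge? H) (IsEdge? G) (edgeᵇ-mono G H H⊆G _) (allPairs _))
        (filter-++-filter-∁-↭ (IsEdge? H) (edgeList G))

greedyStep-edgesFirst : ∀ (G H : Graph n) → IsSpanner k G H → GirthAtLeast (k + 2) H →
  greedyStep k [] (edgesFirst G H) ≡ reverse (edgeList H)
greedyStep-edgesFirst {k = k} G H (_ , stretch) girth = begin
  greedyStep k [] (edgeList H ++ rest)             ≡⟨ greedyStep-++ [] (edgeList H) rest ⟩
  greedyStep k (greedyStep k [] (edgeList H)) rest ≡⟨ cong (λ acc → greedyStep k acc rest)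
                                                          (greedyStep-accepts H girth [] (edgeList H) refl λ ()) ⟩
  greedyStep k (reverse (edgeList H)) rest         ≡⟨ greedyStep-rejects (All.tabulate spanned) ⟩
  reverse (edgeList H)                             ∎
  where
  open ≡-Reasoning
  rest = filter (∁? (IsEdge? H)) (edgeList G)
  spanned : ∀ {p} → p ∈ rest → reach (adjOf (reverse (edgeList H))) k (proj₁ p) (proj₂ p) ≡ true
  spanned {u , v} p∈ = begin
    reach (adjOf (reverse (edgeList H))) k u v ≡⟨ reach-cong (adj≡adjOf-reverse-edgeList H) k u v ⟨
    reach (adj H) k u v                        ≡⟨ cong (λ d → reach (adj H) d u v) (*-identityʳ k) ⟨
    reach (adj H) (k * 1) u v                  ≡⟨ stretch u v 1 (reach-edge (adj G) Guv) ⟩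
    true                                       ∎
    where
    Guv : adj G u v ≡ true
    Guv = proj₂ (∈-edgeList⁻ G (proj₁ (∈-filter⁻ (∁? (IsEdge? H)) {xs = edgeList G} p∈)))

largeGirthSpanner⇒greedyOutput : ∀ (G H : Graph n) → IsSpanner k G H → GirthAtLeast (k + 2) H →
  IsGreedyOutput k G H
largeGirthSpanner⇒greedyOutput {k = k} G H spanner girth =
  edgesFirst G H , edgesFirst-↭ G H (proj₁ spanner) , λ i j → begin
    adj H i j                                    ≡⟨ adj≡adjOf-reverse-edgeList H i j ⟩
    adjOf (reverse (edgeList H)) i j             ≡⟨ cong (λ es → adjOf es i j)
                                                         (greedyStep-edgesFirst G H spanner girth) ⟨
    adjOf (greedyStep k [] (edgesFirst G H)) i j ∎
  where open ≡-Reasoning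

corollary1p5 : ∀ (n k : ℕ) → 1 ≤ n → 1 ≤ k →
    (ExtremelyGood n k → CompletelyUniversallyOptimal n k) × (Good n k → UniversallyOptimal n k)
corollary1p5 n k _ _ = completely , universally
  where
  completely : ExtremelyGood n k → CompletelyUniversallyOptimal n k
  completely extremelyGood G H minimum =
    largeGirthSpanner⇒greedyOutput G H (proj₁ minimum) (extremelyGood G H minimum)
  universally : Good n k → UniversallyOptimal n k
  universally good G =
    let H , minimum , girth = good G
    in H , minimum , largeGirthSpanner⇒greedyOutput G H (proj₁ minimum) girth
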